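{- Let $\phi\in\mathcal{L}_C$ be such that $\vdash\phi$ is derivable in DBL$_\ast$. Then $\vdash_C\phi$.
   Context: Fix a finite set $\Theta$ of atomic propositions and $\theta_1\in\Theta$. $\mathcal{L}$ is the smallest set containing $\Theta$ and closed under $\neg\phi$, $\phi\rightarrow\psi$, $(\psi|\phi)$; $\mathcal{L}_C\subset\mathcal{L}$ is the smallest set containing $\Theta$ and closed under $\neg$ and $\rightarrow$ only. Abbreviations: $\phi\vee\psi:=\neg\phi\rightarrow\psi$, $\phi\wedge\psi:=\neg(\neg\phi\vee\neg\psi)$, $\phi\leftrightarrow\psi:=(\phi\rightarrow\psi)\wedge(\psi\rightarrow\phi)$, $\psi\times\phi:=(\psi|\phi)\leftrightarrow\psi$, $\top:=\theta_1\rightarrow\theta_1$, $\bot:=\neg\top$. A sequent is a pair of finite (possibly empty) sequences $\Gamma,\Delta$ of formulas, written $\Gamma\vdash\Delta$; $\{\Gamma\}$ is the set of entries of $\Gamma$. The classical system $\mathcal{C}$ is the smallest set of sequents closed under (CUT) from $\Gamma\vdash\Delta,\phi$ and $\Lambda,\phi\vdash\Sigma$ infer $\Gamma,\Lambda\vdash\Delta,\Sigma$, and (STRUCT) if $\{\Gamma\}\subset\{\Lambda\}\cup\{\top\}$, $\{\Delta\}\subset\{\Sigma\}\cup\{\bot\}$, from $\Gamma\vdash\Delta$ infer $\Lambda\vdash\Sigma$, and containing for all $\phi,\psi,\eta$: $\phi,\phi\rightarrow\psi\vdash\psi$; $\vdash\phi\rightarrow(\psi\rightarrow\phi)$; $\vdash(\eta\rightarrow(\phi\rightarrow\psi))\rightarrow((\eta\rightarrow\phi)\rightarrow(\eta\rightarrow\psi))$;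 $\vdash(\neg\phi\rightarrow\neg\psi)\rightarrow((\neg\phi\rightarrow\psi)\rightarrow\phi)$; derivability in it is written $\vdash_C$. DBL$_\ast$ is the smallest set of sequents with the same closure conditions and axioms, and additionally containing for all $\phi,\psi,\eta$: $\phi\rightarrow\psi\vdash\neg\phi,(\psi|\phi)$; $\vdash(\psi\rightarrow\eta|\phi)\rightarrow((\psi|\phi)\rightarrow(\eta|\phi))$; $\vdash(\psi|\phi)\rightarrow(\phi\rightarrow\psi)$; $\vdash\neg(\neg\psi|\phi)\leftrightarrow(\psi|\phi)$; $\psi\times\neg\phi\vdash\psi\times\phi$; $\psi\times\phi\vdash\psi\times\neg\phi$; $\psi\leftrightarrow\eta\vdash(\phi|\psi)\leftrightarrow(\phi|\eta)$. -}

module Defs where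

open import Data.Nat using (ℕ; suc)
open import Data.Fin using (Fin; zero)
open import Data.List using (List; []; _∷_; _++_)
open import Data.List.Membership.Propositional using (_∈_)
open import Data.Sum using (_⊎_)
open import Relation.Binary.PropositionalEquality using (_≡_)

-- The finite set Θ of atomic propositions is Fin (suc n) (nonempty, since θ₁ ∈ Θ);
-- θ₁ is  zero.
module Logic (n : ℕ) where

  Atom : Set
  Atom = Fin (suc n)

  θ₁ : Atom
  θ₁ = zero

  data Form : Set where
    atom : Atom → Form
    ¬'_  : Form → Form
    _⇒_  : Form → Form → Form
    ⟨_∣_⟩ : Form → Form → Form

  infixr 5 _⇒_

  data Classical : Form → Set where
    c-atom : ∀ a → Classical (atom a)
    c-neg  : ∀ {φ} → Classical φ → Classical (¬' φ)
    c-imp  : ∀ {φ ψ} → Classical φ → Classical ψ → Classical (φ ⇒ ψ)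

  _∨'_ : Form → Form → Form
  φ ∨' ψ = (¬' φ) ⇒ ψ

  _∧'_ : Form → Form → Form
  φ ∧' ψ = ¬' ((¬' φ) ∨' (¬' ψ))

  _⇔_ : Form → Form → Form
  φ ⇔ ψ = (φ ⇒ ψ) ∧' (ψ ⇒ φ)

  _×'_ : Form → Form → Form
  ψ ×' φ = ⟨ ψ ∣ φ ⟩ ⇔ ψ

  ⊤' : Form
  ⊤' = atom θ₁ ⇒ atom θ₁

  ⊥' : Form
  ⊥' = ¬' ⊤'

  Seq : Set
  Seq = List Form

  _⊆_∪_ : Seq → Seq → Form → Set
  Γ ⊆ Λ ∪ e = ∀ {χ} → χ ∈ Γ → χ ∈ Λ ⊎ χ ≡ e

  data _⊢C_ : Seq → Seq → Set where
    cut    : ∀ {Γ Δ Λ Σ φ} → Γ ⊢C (Δ ++ φ ∷ []) → (Λ ++ φ ∷ []) ⊢C Σ →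
             (Γ ++ Λ) ⊢C (Δ ++ Σ)
    struct : ∀ {Γ Δ Λ Σ} → Γ ⊆ Λ ∪ ⊤' → Δ ⊆ Σ ∪ ⊥' → Γ ⊢C Δ → Λ ⊢C Σ
    mp     : ∀ φ ψ → (φ ∷ (φ ⇒ ψ) ∷ []) ⊢C (ψ ∷ [])
    ax1    : ∀ φ ψ → [] ⊢C ((φ ⇒ (ψ ⇒ φ)) ∷ [])
    ax2    : ∀ η φ ψ →
             [] ⊢C (((η ⇒ (φ ⇒ ψ)) ⇒ ((η ⇒ φ) ⇒ (η ⇒ ψ))) ∷ [])
    ax3    : ∀ φ ψ →
             [] ⊢C ((((¬' φ) ⇒ (¬' ψ)) ⇒ (((¬' φ) ⇒ ψ) ⇒ φ)) ∷ [])

  data _⊢D_ : Seq → Seq → Set where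
    cut    : ∀ {Γ Δ Λ Σ φ} → Γ ⊢D (Δ ++ φ ∷ []) → (Λ ++ φ ∷ []) ⊢D Σ →
             (Γ ++ Λ) ⊢D (Δ ++ Σ)
    struct : ∀ {Γ Δ Λ Σ} → Γ ⊆ Λ ∪ ⊤' → Δ ⊆ Σ ∪ ⊥' → Γ ⊢D Δ → Λ ⊢D Σ
    mp     : ∀ φ ψ → (φ ∷ (φ ⇒ ψ) ∷ []) ⊢D (ψ ∷ [])
    ax1    : ∀ φ ψ → [] ⊢D ((φ ⇒ (ψ ⇒ φ)) ∷ [])
    ax2    : ∀ η φ ψ →
             [] ⊢D (((η ⇒ (φ ⇒ ψ)) ⇒ ((η ⇒ φ) ⇒ (η ⇒ ψ))) ∷ [])
    ax3    : ∀ φ ψ →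
             [] ⊢D ((((¬' φ) ⇒ (¬' ψ)) ⇒ (((¬' φ) ⇒ ψ) ⇒ φ)) ∷ [])
    d1     : ∀ φ ψ → ((φ ⇒ ψ) ∷ []) ⊢D ((¬' φ) ∷ ⟨ ψ ∣ φ ⟩ ∷ [])
    d2     : ∀ φ ψ η →
             [] ⊢D ((⟨ ψ ⇒ η ∣ φ ⟩ ⇒ (⟨ ψ ∣ φ ⟩ ⇒ ⟨ η ∣ φ ⟩)) ∷ [])
    d3     : ∀ φ ψ → [] ⊢D ((⟨ ψ ∣ φ ⟩ ⇒ (φ ⇒ ψ)) ∷ [])
    d4     : ∀ φ ψ → [] ⊢D (((¬' ⟨ ¬' ψ ∣ φ ⟩) ⇔ ⟨ ψ ∣ φ ⟩) ∷ [])
    d5     : ∀ φ ψ → ((ψ ×' (¬' φ)) ∷ []) ⊢D ((ψ ×' φ) ∷ [])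
    d6     : ∀ φ ψ → ((ψ ×' φ) ∷ []) ⊢D ((ψ ×' (¬' φ)) ∷ [])
    d7     : ∀ φ ψ η → ((ψ ⇔ η) ∷ []) ⊢D ((⟨ φ ∣ ψ ⟩ ⇔ ⟨ φ ∣ η ⟩) ∷ [])

{-# OPTIONS --safe #-}
-- Reading every conditional (ψ|φ) as its consequent ψ turns each axiom of DBL∗
-- into a two-valued tautology (of the shape α ⇒ α, α ⇔ α or a classical axiom),
-- and the rules preserve validity, so a DBL∗-theorem is a tautology under this
-- reading.  On 𝓛_C the reading is ordinary two-valued semantics, and Kalmár's
-- completeness argument for the Hilbert system with axioms ax1–ax3 and modus
-- ponens yields a derivation in 𝓒.  The detour through semantics is forced by
-- the two-conclusion axiom d1, whose conditional-free image 𝓒 cannot derive.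
module Submission where

open import Defs
open import Data.Nat using (ℕ; suc)
open import Data.Bool using (Bool; true; false; not; _∨_)
open import Data.Fin using (_≟_)
open import Data.List using (List; []; _∷_; map; allFin)
open import Data.List.Relation.Unary.All using (All; []; _∷_)
import Data.List.Relation.Unary.All as All
import Data.List.Relation.Unary.All.Properties as All
open import Data.List.Relation.Unary.Any using (Any; here; there)
import Data.List.Relation.Unary.Any.Properties as Any
open import Data.List.Membership.Propositional using (_∈_; find; lose)
open import Data.List.Membership.Propositional.Properties using (∈-map⁺; ∈-map⁻; ∈-allFin)
open import Data.List.Relation.Binary.Subset.Propositional using (_⊆_)
open import Data.Product using (_,_)
open import Data.Sum using (_⊎_; inj₁; inj₂; [_,_]′)
open import Data.Vec.Functional using (Vector; updateAt)
open import Data.Vec.Functional.Properties using (updateAt-updates; updateAt-minimal)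
open import Function using (const; _∘_)
open import Relation.Nullary using (¬_; yes; no; contradiction)
open import Relation.Unary using (Pred)
open import Relation.Binary.PropositionalEquality using (_≡_; refl; sym; cong; subst)

module Conservativity (n : ℕ) where
  open Logic n

  variable
    Γ Δ Λ Σ : List Form
    φ ψ : Form

  All-⊆∪ : ∀ {p} {P : Pred Form p} {e} → Γ ⊆ Λ ∪ e → P e → All P Λ → All P Γ
  All-⊆∪ Γ⊆Λ∪e Pe PΛ =
    All.tabulate (λ x∈Γ → [ All.lookup PΛ , (λ { refl → Pe }) ]′ (Γ⊆Λ∪e x∈Γ))

  Any-⊆∪ : ∀ {p} {P : Pred Form p} {e} → Δ ⊆ Σ ∪ e → ¬ P e → Any P Δ → Any P Σ
  Any-⊆∪ Δ⊆Σ∪e ¬Pe PΔ with find PΔ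
  ... | x , x∈Δ , Px with Δ⊆Σ∪e x∈Δ
  ...   | inj₁ x∈Σ = lose x∈Σ Px
  ...   | inj₂ refl = contradiction Px ¬Pe

  Valuation : Set
  Valuation = Vector Bool (suc n)

  ⟦_⟧ : Form → Valuation → Bool
  ⟦ atom a ⟧ v = v a
  ⟦ ¬' φ ⟧ v = not (⟦ φ ⟧ v)
  ⟦ φ ⇒ ψ ⟧ v = not (⟦ φ ⟧ v) ∨ ⟦ ψ ⟧ v
  ⟦ ⟨ ψ ∣ φ ⟩ ⟧ v = ⟦ ψ ⟧ v

  infix 4 _⊨_ _⊫_

  _⊨_ : Valuation → Form → Set
  v ⊨ φ = ⟦ φ ⟧ v ≡ true

  _⊫_ : Seq → Seq → Set
  Γ ⊫ Δ = ∀ v → All (v ⊨_) Γ → Any (v ⊨_) Δ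

  ⊨⊤ : ∀ v → v ⊨ ⊤'
  ⊨⊤ v with v θ₁
  ... | true = refl
  ... | false = refl

  ⊭⊥ : ∀ v → ¬ v ⊨ ⊥'
  ⊭⊥ v with v θ₁
  ... | true = λ ()
  ... | false = λ ()

  ⊨-mp : ∀ v φ ψ → v ⊨ φ → v ⊨ φ ⇒ ψ → v ⊨ ψ
  ⊨-mp v φ ψ ⊨φ = subst (λ b → not b ∨ ⟦ ψ ⟧ v ≡ true) ⊨φ

  ⊨⇒⁻ : ∀ v φ ψ → v ⊨ φ ⇒ ψ → v ⊨ ¬' φ ⊎ v ⊨ ψ
  ⊨⇒⁻ v φ ψ ⊨φ⇒ψ with ⟦ φ ⟧ v
  ... | true = inj₂ ⊨φ⇒ψ
  ... | false = inj₁ refl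

  ⊨⇒-refl : ∀ v φ → v ⊨ φ ⇒ φ
  ⊨⇒-refl v φ with ⟦ φ ⟧ v
  ... | true = refl
  ... | false = refl

  ⊨⇔-refl : ∀ v φ → v ⊨ φ ⇔ φ
  ⊨⇔-refl v φ with ⟦ φ ⟧ v
  ... | true = refl
  ... | false = refl

  ⊨¬¬⇔ : ∀ v φ → v ⊨ (¬' ¬' φ) ⇔ φ
  ⊨¬¬⇔ v φ with ⟦ φ ⟧ v
  ... | true = refl
  ... | false = refl

  ⊨-ax1 : ∀ v φ ψ → v ⊨ φ ⇒ ψ ⇒ φ
  ⊨-ax1 v φ ψ with ⟦ φ ⟧ v | ⟦ ψ ⟧ v
  ... | true | true = refl
  ... | true | false = refl
  ... | false | _ = refl

  ⊨-ax2 : ∀ v η φ ψ → v ⊨ (η ⇒ φ ⇒ ψ) ⇒ (η ⇒ φ) ⇒ η ⇒ ψ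
  ⊨-ax2 v η φ ψ with ⟦ η ⟧ v | ⟦ φ ⟧ v | ⟦ ψ ⟧ v
  ... | true | true | true = refl
  ... | true | true | false = refl
  ... | true | false | _ = refl
  ... | false | _ | _ = refl

  ⊨-ax3 : ∀ v φ ψ → v ⊨ (¬' φ ⇒ ¬' ψ) ⇒ (¬' φ ⇒ ψ) ⇒ φ
  ⊨-ax3 v φ ψ with ⟦ φ ⟧ v | ⟦ ψ ⟧ v
  ... | true | _ = refl
  ... | false | true = refl
  ... | false | false = refl

  ⊢D-sound : Γ ⊢D Δ → Γ ⊫ Δ
  ⊢D-sound (cut {Γ} {Δ} d e) v ⊨Γ++Λ
    with Any.++⁻ Δ (⊢D-sound d v (All.++⁻ˡ Γ ⊨Γ++Λ))
  ... | inj₁ ⊨Δ = Any.++⁺ˡ ⊨Δ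
  ... | inj₂ (here ⊨φ) =
    Any.++⁺ʳ Δ (⊢D-sound e v (All.∷ʳ⁺ (All.++⁻ʳ Γ ⊨Γ++Λ) ⊨φ))
  ⊢D-sound (struct Γ⊆Λ∪⊤ Δ⊆Σ∪⊥ d) v ⊨Λ =
    Any-⊆∪ Δ⊆Σ∪⊥ (⊭⊥ v) (⊢D-sound d v (All-⊆∪ Γ⊆Λ∪⊤ (⊨⊤ v) ⊨Λ))
  ⊢D-sound (mp φ ψ) v (⊨φ ∷ ⊨φ⇒ψ ∷ []) = here (⊨-mp v φ ψ ⊨φ ⊨φ⇒ψ)
  ⊢D-sound (ax1 φ ψ) v _ = here (⊨-ax1 v φ ψ)
  ⊢D-sound (ax2 η φ ψ) v _ = here (⊨-ax2 v η φ ψ)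
  ⊢D-sound (ax3 φ ψ) v _ = here (⊨-ax3 v φ ψ)
  ⊢D-sound (d1 φ ψ) v (⊨φ⇒ψ ∷ []) =
    [ here , there ∘ here ]′ (⊨⇒⁻ v φ ψ ⊨φ⇒ψ)
  ⊢D-sound (d2 φ ψ η) v _ = here (⊨⇒-refl v (ψ ⇒ η))
  ⊢D-sound (d3 φ ψ) v _ = here (⊨-ax1 v ψ φ)
  ⊢D-sound (d4 φ ψ) v _ = here (⊨¬¬⇔ v ψ)
  ⊢D-sound (d5 φ ψ) v _ = here (⊨⇔-refl v ψ)
  ⊢D-sound (d6 φ ψ) v _ = here (⊨⇔-refl v ψ)
  ⊢D-sound (d7 φ ψ η) v _ = here (⊨⇔-refl v φ)

  infix 3 _⊢H_

  data _⊢H_ (Γ : List Form) : Form → Set where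
    hyp : φ ∈ Γ → Γ ⊢H φ
    ax1 : ∀ φ ψ → Γ ⊢H φ ⇒ ψ ⇒ φ
    ax2 : ∀ η φ ψ → Γ ⊢H (η ⇒ φ ⇒ ψ) ⇒ (η ⇒ φ) ⇒ η ⇒ ψ
    ax3 : ∀ φ ψ → Γ ⊢H (¬' φ ⇒ ¬' ψ) ⇒ (¬' φ ⇒ ψ) ⇒ φ
    mp  : Γ ⊢H φ → Γ ⊢H φ ⇒ ψ → Γ ⊢H ψ

  #0 : φ ∷ Γ ⊢H φ
  #0 = hyp (here refl)

  #1 : ψ ∷ φ ∷ Γ ⊢H φ
  #1 = hyp (there (here refl))

  ⊢H-weaken : Γ ⊆ Δ → Γ ⊢H φ → Δ ⊢H φ
  ⊢H-weaken Γ⊆Δ (hyp φ∈Γ) = hyp (Γ⊆Δ φ∈Γ)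
  ⊢H-weaken Γ⊆Δ (ax1 φ ψ) = ax1 φ ψ
  ⊢H-weaken Γ⊆Δ (ax2 η φ ψ) = ax2 η φ ψ
  ⊢H-weaken Γ⊆Δ (ax3 φ ψ) = ax3 φ ψ
  ⊢H-weaken Γ⊆Δ (mp d e) = mp (⊢H-weaken Γ⊆Δ d) (⊢H-weaken Γ⊆Δ e)

  ⊢H-wk : Γ ⊢H φ → ψ ∷ Γ ⊢H φ
  ⊢H-wk = ⊢H-weaken there

  ⊢H-K : Γ ⊢H φ → Γ ⊢H ψ ⇒ φ
  ⊢H-K d = mp d (ax1 _ _)

  ⊢H-refl : ∀ φ → Γ ⊢H φ ⇒ φ
  ⊢H-refl φ = mp (ax1 φ φ) (mp (ax1 φ (φ ⇒ φ)) (ax2 φ (φ ⇒ φ) φ))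

  deduction : φ ∷ Γ ⊢H ψ → Γ ⊢H φ ⇒ ψ
  deduction (hyp (here refl)) = ⊢H-refl _
  deduction (hyp (there ψ∈Γ)) = ⊢H-K (hyp ψ∈Γ)
  deduction (ax1 φ ψ) = ⊢H-K (ax1 φ ψ)
  deduction (ax2 η φ ψ) = ⊢H-K (ax2 η φ ψ)
  deduction (ax3 φ ψ) = ⊢H-K (ax3 φ ψ)
  deduction (mp d e) = mp (deduction d) (mp (deduction e) (ax2 _ _ _))

  ¬¬-elim : ∀ {φ Γ} → ¬' ¬' φ ∷ Γ ⊢H φ
  ¬¬-elim {φ} = mp (⊢H-refl (¬' φ)) (mp (⊢H-K #0) (ax3 φ (¬' φ)))

  ¬¬-intro : ∀ {φ Γ} → φ ∷ Γ ⊢H ¬' ¬' φ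
  ¬¬-intro {φ} = mp (⊢H-K #0) (mp (deduction ¬¬-elim) (ax3 (¬' ¬' φ) φ))

  ex-falso : ∀ {φ ψ Γ} → φ ∷ ¬' φ ∷ Γ ⊢H ψ
  ex-falso {φ} {ψ} = mp (⊢H-K #0) (mp (⊢H-K #1) (ax3 ψ φ))

  contraposition : ∀ {φ ψ Γ} → Γ ⊢H φ ⇒ ψ → ¬' ψ ∷ Γ ⊢H ¬' φ
  contraposition {φ} {ψ} ⊢φ⇒ψ =
    mp (deduction (mp ¬¬-elim (⊢H-wk (⊢H-wk ⊢φ⇒ψ)))) (mp (⊢H-K #0) (ax3 (¬' φ) ψ))

  ¬⇒-intro : ∀ {φ ψ Γ} → ¬' ψ ∷ φ ∷ Γ ⊢H ¬' (φ ⇒ ψ)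
  ¬⇒-intro {φ} {ψ} =
    mp (deduction (mp (⊢H-wk #1) ¬¬-elim)) (mp (⊢H-K #0) (ax3 (¬' (φ ⇒ ψ)) ψ))

  ⊢H-cases : ∀ {φ ψ Γ} → φ ∷ Γ ⊢H ψ → ¬' φ ∷ Γ ⊢H ψ → Γ ⊢H ψ
  ⊢H-cases {φ} {ψ} ⊢ψ ⊢ψ′ =
    mp (deduction (contraposition (deduction ⊢ψ)))
       (mp (deduction (contraposition (deduction ⊢ψ′))) (ax3 ψ (¬' φ)))

  _^_ : Form → Bool → Form
  φ ^ true = φ
  φ ^ false = ¬' φ

  literals : Valuation → List Atom → List Form
  literals v = map (λ a → atom a ^ v a)

  kalmar : ∀ v → Classical φ → literals v (allFin _) ⊢H φ ^ ⟦ φ ⟧ v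
  kalmar v (c-atom a) = hyp (∈-map⁺ _ (∈-allFin a))
  kalmar v (c-neg {φ} c) with ⟦ φ ⟧ v | kalmar v c
  ... | true | ⊢φ = mp ⊢φ (deduction ¬¬-intro)
  ... | false | ⊢¬φ = ⊢¬φ
  kalmar v (c-imp {φ} {ψ} c c′) with ⟦ φ ⟧ v | kalmar v c | ⟦ ψ ⟧ v | kalmar v c′
  ... | true | _ | true | ⊢ψ = ⊢H-K ⊢ψ
  ... | false | _ | true | ⊢ψ = ⊢H-K ⊢ψ
  ... | false | ⊢¬φ | false | _ = mp ⊢¬φ (deduction (deduction ex-falso))
  ... | true | ⊢φ | false | ⊢¬ψ = mp ⊢¬ψ (mp ⊢φ (deduction (deduction ¬⇒-intro)))

  literals-updateAt-⊆ : ∀ v a b L →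
    literals (updateAt v a (const b)) (a ∷ L) ⊆ atom a ^ b ∷ literals v L
  literals-updateAt-⊆ v a b L ℓ∈ with ∈-map⁻ _ ℓ∈
  ... | c , c∈a∷L , refl with c ≟ a | c∈a∷L
  ...   | yes refl | _ = here (cong (atom a ^_) (updateAt-updates a v))
  ...   | no c≢a | here c≡a = contradiction c≡a c≢a
  ...   | no c≢a | there c∈L =
    there (subst (λ b′ → atom c ^ b′ ∈ literals v L) (sym (updateAt-minimal c a v c≢a))
                 (∈-map⁺ _ c∈L))

  literals-elim : ∀ {φ} L → (∀ v → literals v L ⊢H φ) → [] ⊢H φ
  literals-elim [] ⊢φ = ⊢φ (const true)
  literals-elim {φ} (a ∷ L) ⊢φ =
    literals-elim L (λ v → ⊢H-cases (fixing v true) (fixing v false))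
    where
    fixing : ∀ v b → atom a ^ b ∷ literals v L ⊢H φ
    fixing v b = ⊢H-weaken (literals-updateAt-⊆ v a b L) (⊢φ (updateAt v a (const b)))

  ⊢H-complete : ∀ {φ} → Classical φ → (∀ v → v ⊨ φ) → [] ⊢H φ
  ⊢H-complete {φ} c ⊨φ = literals-elim (allFin _) λ v →
    subst (λ b → literals v (allFin _) ⊢H φ ^ b) (⊨φ v) (kalmar v c)

  ⊢C-mp : ∀ {φ ψ} → [] ⊢C (φ ∷ []) → [] ⊢C ((φ ⇒ ψ) ∷ []) → [] ⊢C (ψ ∷ [])
  ⊢C-mp {φ} {ψ} ⊢φ ⊢φ⇒ψ =
    cut {Γ = []} {Δ = []} {Λ = []} ⊢φ
        (cut {Γ = []} {Δ = []} {Λ = φ ∷ []} ⊢φ⇒ψ (mp φ ψ))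

  ⊢H⇒⊢C : [] ⊢H φ → [] ⊢C (φ ∷ [])
  ⊢H⇒⊢C (ax1 φ ψ) = ax1 φ ψ
  ⊢H⇒⊢C (ax2 η φ ψ) = ax2 η φ ψ
  ⊢H⇒⊢C (ax3 φ ψ) = ax3 φ ψ
  ⊢H⇒⊢C (mp d e) = ⊢C-mp (⊢H⇒⊢C d) (⊢H⇒⊢C e)

proposition6 : (n : ℕ) → (φ : Logic.Form n) → Logic.Classical n φ →
    Logic._⊢D_ n [] (φ ∷ []) → Logic._⊢C_ n [] (φ ∷ [])
proposition6 n φ c ⊢φ =
  ⊢H⇒⊢C (⊢H-complete c λ v → Any.singleton⁻ (⊢D-sound ⊢φ v []))
  where open Conservativity n
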